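{- Let $n \ge 3$ and $X \subseteq \{2,\ldots,n-1\}$. If $S$ is a Hamilton sequence for the restricted rotator graph $\mathrm{Rot}_{n-1}(X)$, then $\mathrm{reuse}_n(S)$ is a Hamilton sequence for the restricted rotator graph $\mathrm{Rot}_n(R)$, where $R = \{n\} \cup \{\, n - x + 1 : x \in X \,\}$.
   Context: $\Pi_k$ is the set of strings that are permutations of $\{1,\ldots,k\}$. For $2 \le r \le k$, the prefix-rotation $\sigma_r$ maps $a_1 \cdots a_k$ to $a_2 \cdots a_r a_1 a_{r+1} \cdots a_k$. For $R \subseteq \{2,\ldots,k\}$, $\mathrm{Rot}_k(R)$ is the directed graph with node set $\Pi_k$ and an arc from $\mathbf{a}$ to $\mathbf{b}$ whenever $\mathbf{b} = \mathbf{a}\sigma_r$ for some $r \in R$. A Hamilton sequence for $\mathrm{Rot}_k(R)$ is a sequence $r_1,\ldots,r_{k!}$ of elements of $R$ such that, with $v_0 = k\,(k{ - }1)\cdots 1$ and $v_i = v_{i-1}\sigma_{r_i}$, the strings $v_0,\ldots,v_{k!-1}$ are pairwise distinct (hence all of $\Pi_k$) and $v_{k!} = v_0$. The reuse operation $\mathrm{reuse}_n(S)$ replaces each entry $r$ of a sequence $S$ by $n$ repeated $n-1$ times followed by $n+1-r$. -}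

module Defs where

open import Data.Nat using (ℕ; suc; _+_; _∸_; _≤_; _!)

open import Data.List using (List; []; _∷_; _++_; [_]; take; drop; map; downFrom; length; replicate; concatMap)
open import Data.List.Relation.Unary.All using (All)
open import Data.List.Relation.Unary.Unique.Propositional using (Unique)
open import Data.Product using (_×_)
open import Relation.Binary.PropositionalEquality using (_≡_)

rotl : List ℕ → List ℕ
rotl []       = []
rotl (x ∷ xs) = xs ++ [ x ]

σ : ℕ → List ℕ → List ℕ
σ r a = rotl (take r a) ++ drop r a

start : ℕ → List ℕ
start k = map suc (downFrom k)

visited : List ℕ → List ℕ → List (List ℕ)
visited v []       = []
visited v (r ∷ rs) = v ∷ visited (σ r v) rs

final : List ℕ → List ℕ → List ℕ
final v []       = v
final v (r ∷ rs) = final (σ r v) rs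

IsHamiltonSeq : ℕ → (ℕ → Set) → List ℕ → Set
IsHamiltonSeq k R S =
  length S ≡ k ! × All R S × Unique (visited (start k) S) × final (start k) S ≡ start k

reuse : ℕ → List ℕ → List ℕ
reuse n S = concatMap (λ r → replicate (n ∸ 1) n ++ [ n + 1 ∸ r ]) S

-- Write n = m + 1 and encode a string u of Π_m as lift u = n · ū, where ū is u reversed with
-- every letter x replaced by n − x.  On a string of length n the rotation σ_n is a full left
-- rotation, so the n − 1 copies of n in the block of reuse_n(S) for an entry r rotate lift u
-- until the last letter of ū comes first; the closing σ_{n+1−r} then yields exactly lift (u σ_r).
-- Hence reuse_n(S) visits, for every u visited by S, the n rotations of lift u and ends at
-- lift (final u S).  A rotation of lift u is decoded by cutting it at its unique letter n, which
-- recovers u together with the rotation offset, so distinct pairs (u, offset) give distinct strings.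
module Submission where

open import Defs
open import Data.Nat using (ℕ; zero; suc; _+_; _*_; _∸_; _≤_; _<_; _≟_; z≤n; s≤s)
open import Data.Nat.Properties
  using (+-comm; +-suc; *-suc; *-zeroʳ; +-∸-comm; m+n∸m≡n; m∸[m∸n]≡n; m∸n≤m; m≤n⇒m⊓n≡m; m≤n⇒m≤1+n;
         <⇒≤; <⇒≢; >⇒≢; ≤-trans)
open import Data.Nat.GeneralisedArithmetic using (iterate)
open import Data.Product using (Σ; _×_; ∃-syntax; _,_; proj₁; proj₂; map₁)
open import Data.Sum using (_⊎_; inj₁; inj₂)
open import Data.List
  using (List; []; _∷_; _++_; [_]; take; drop; map; reverse; replicate; length;
         downFrom; upTo; applyUpTo; applyDownFrom; cartesianProduct)
open import Data.List.Properties
  using (++-assoc; ++-identityʳ; length-++; length-map; length-take; length-reverse;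
         length-replicate; length-downFrom; take++drop≡id; map-++; map-∘; map-id-local;
         map-applyUpTo; map-upTo; map-downFrom; reverse-++; reverse-map; reverse-involutive;
         reverse-applyDownFrom)
open import Data.List.Relation.Unary.All as All using (All; []; _∷_)
import Data.List.Relation.Unary.All.Properties as All
open import Data.List.Relation.Unary.AllPairs using (_∷_)
open import Data.List.Relation.Unary.Unique.Propositional using (Unique)
import Data.List.Relation.Unary.Unique.Propositional.Properties as Unique
open import Data.List.Relation.Binary.Permutation.Propositional using (↭-sym)
open import Data.List.Relation.Binary.Permutation.Propositional.Properties using (All-resp-↭; ↭-reverse)
open import Relation.Binary.PropositionalEquality
  using (_≡_; _≢_; refl; sym; trans; cong; cong₂; subst; module ≡-Reasoning)
open import Relation.Nullary using (yes; no; contradiction)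

open ≡-Reasoning

length-rotl : ∀ xs → length (rotl xs) ≡ length xs
length-rotl []       = refl
length-rotl (x ∷ xs) = trans (length-++ xs) (+-comm (length xs) 1)

length-σ : ∀ r xs → length (σ r xs) ≡ length xs
length-σ r xs = begin
  length (rotl (take r xs) ++ drop r xs)        ≡⟨ length-++ (rotl (take r xs)) ⟩
  length (rotl (take r xs)) + length (drop r xs) ≡⟨ cong (_+ length (drop r xs)) (length-rotl (take r xs)) ⟩
  length (take r xs) + length (drop r xs)        ≡⟨ sym (length-++ (take r xs)) ⟩
  length (take r xs ++ drop r xs)                ≡⟨ cong length (take++drop≡id r xs) ⟩
  length xs                                      ∎

All-rotl : ∀ {P : ℕ → Set} {xs} → All P xs → All P (rotl xs)
All-rotl []       = []
All-rotl (p ∷ ps) = All.++⁺ ps (p ∷ [])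

All-σ : ∀ {P : ℕ → Set} r {xs} → All P xs → All P (σ r xs)
All-σ r ps = All.++⁺ (All-rotl (All.take⁺ r ps)) (All.drop⁺ r ps)

take-length-++ : ∀ (xs ys : List ℕ) → take (length xs) (xs ++ ys) ≡ xs
take-length-++ []       ys = refl
take-length-++ (x ∷ xs) ys = cong (x ∷_) (take-length-++ xs ys)

drop-length-++ : ∀ (xs ys : List ℕ) → drop (length xs) (xs ++ ys) ≡ ys
drop-length-++ []       ys = refl
drop-length-++ (x ∷ xs) ys = drop-length-++ xs ys

σ-++ : ∀ xs ys → σ (length xs) (xs ++ ys) ≡ rotl xs ++ ys
σ-++ xs ys = cong₂ (λ p q → rotl p ++ q) (take-length-++ xs ys) (drop-length-++ xs ys)

iterate-rotl-++ : ∀ xs ys → iterate rotl (xs ++ ys) (length xs) ≡ ys ++ xs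
iterate-rotl-++ []       ys = sym (++-identityʳ ys)
iterate-rotl-++ (x ∷ xs) ys = begin
  iterate rotl ((xs ++ ys) ++ [ x ]) (length xs)
    ≡⟨ cong (λ zs → iterate rotl zs (length xs)) (++-assoc xs ys [ x ]) ⟩
  iterate rotl (xs ++ ys ++ [ x ]) (length xs)
    ≡⟨ iterate-rotl-++ xs (ys ++ [ x ]) ⟩
  (ys ++ [ x ]) ++ xs
    ≡⟨ ++-assoc ys [ x ] xs ⟩
  ys ++ x ∷ xs ∎

iterate-rotl-split : ∀ i xs ys → i ≤ length xs →
                     iterate rotl (xs ++ ys) i ≡ drop i xs ++ ys ++ take i xs
iterate-rotl-split i xs ys i≤ = begin
  iterate rotl (xs ++ ys) i
    ≡⟨ cong (λ zs → iterate rotl (zs ++ ys) i) (sym (take++drop≡id i xs)) ⟩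
  iterate rotl ((take i xs ++ drop i xs) ++ ys) i
    ≡⟨ cong (λ zs → iterate rotl zs i) (++-assoc (take i xs) (drop i xs) ys) ⟩
  iterate rotl (take i xs ++ drop i xs ++ ys) i
    ≡⟨ cong (iterate rotl _) (sym length-take-i) ⟩
  iterate rotl (take i xs ++ drop i xs ++ ys) (length (take i xs))
    ≡⟨ iterate-rotl-++ (take i xs) (drop i xs ++ ys) ⟩
  (drop i xs ++ ys) ++ take i xs
    ≡⟨ ++-assoc (drop i xs) ys (take i xs) ⟩
  drop i xs ++ ys ++ take i xs ∎
  where
  length-take-i : length (take i xs) ≡ i
  length-take-i = trans (length-take i xs) (m≤n⇒m⊓n≡m i≤)

visited-++ : ∀ v A B → visited v (A ++ B) ≡ visited v A ++ visited (final v A) B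
visited-++ v []      B = refl
visited-++ v (r ∷ A) B = cong (v ∷_) (visited-++ (σ r v) A B)

final-++ : ∀ v A B → final v (A ++ B) ≡ final (final v A) B
final-++ v []      B = refl
final-++ v (r ∷ A) B = final-++ (σ r v) A B

σ-full : ∀ {k} x → length x ≡ k → σ k x ≡ rotl x
σ-full x refl = begin
  σ (length x) x         ≡⟨ cong (σ (length x)) (sym (++-identityʳ x)) ⟩
  σ (length x) (x ++ []) ≡⟨ σ-++ x [] ⟩
  rotl x ++ []           ≡⟨ ++-identityʳ (rotl x) ⟩
  rotl x                 ∎

visited-rotations : ∀ {k} x j y → length x ≡ k →
                    visited x (replicate j k ++ [ y ]) ≡ applyUpTo (iterate rotl x) (suc j)
visited-rotations x zero    y lx = refl
visited-rotations {k} x (suc j) y lx = cong (x ∷_) (begin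
  visited (σ k x) (replicate j k ++ [ y ]) ≡⟨ cong (λ z → visited z (replicate j k ++ [ y ])) (σ-full x lx) ⟩
  visited (rotl x) (replicate j k ++ [ y ]) ≡⟨ visited-rotations (rotl x) j y (trans (length-rotl x) lx) ⟩
  applyUpTo (iterate rotl (rotl x)) (suc j) ∎)

final-rotations : ∀ {k} x j y → length x ≡ k →
                  final x (replicate j k ++ [ y ]) ≡ σ y (iterate rotl x j)
final-rotations x zero    y lx = refl
final-rotations {k} x (suc j) y lx = begin
  final (σ k x) (replicate j k ++ [ y ]) ≡⟨ cong (λ z → final z (replicate j k ++ [ y ])) (σ-full x lx) ⟩
  final (rotl x) (replicate j k ++ [ y ]) ≡⟨ final-rotations (rotl x) j y (trans (length-rotl x) lx) ⟩
  σ y (iterate rotl (rotl x) j)          ∎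

cutAt : ℕ → List ℕ → List ℕ × List ℕ
cutAt x []       = [] , []
cutAt x (y ∷ ys) with y ≟ x
... | yes _ = [] , ys
... | no _  = map₁ (y ∷_) (cutAt x ys)

cutAt-++ : ∀ x p q → All (_≢ x) p → cutAt x (p ++ x ∷ q) ≡ (p , q)
cutAt-++ x [] q [] with x ≟ x
... | yes _  = refl
... | no x≢x = contradiction refl x≢x
cutAt-++ x (y ∷ p) q (y≢x ∷ p≢x) with y ≟ x
... | yes y≡x = contradiction y≡x y≢x
... | no _    = cong (map₁ (y ∷_)) (cutAt-++ x p q p≢x)

applyUpTo-∸ : ∀ n → applyUpTo (n ∸_) n ≡ applyDownFrom suc n
applyUpTo-∸ zero    = refl
applyUpTo-∸ (suc n) = cong (suc n ∷_) (applyUpTo-∸ n)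

applyUpTo-cong-< : ∀ {A : Set} {f g : ℕ → A} n → (∀ {i} → i < n → f i ≡ g i) →
                   applyUpTo f n ≡ applyUpTo g n
applyUpTo-cong-< zero    f≡g = refl
applyUpTo-cong-< (suc n) f≡g = cong₂ _∷_ (f≡g (s≤s z≤n)) (applyUpTo-cong-< n (λ i<n → f≡g (s≤s i<n)))

σ-prefix : ∀ a b c → σ (suc (length b)) (a ∷ b ++ c) ≡ b ++ a ∷ c
σ-prefix a b c = trans (σ-++ (a ∷ b) c) (++-assoc b [ a ] c)

split-prefix : ∀ r u → 1 ≤ r → r ≤ length u →
               Σ ℕ λ a → Σ (List ℕ) λ b → Σ (List ℕ) λ c → u ≡ a ∷ b ++ c × r ≡ suc (length b)
split-prefix (suc r) (x ∷ xs) _ (s≤s r≤) =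
  x , take r xs , drop r xs , cong (x ∷_) (sym (take++drop≡id r xs)) ,
  cong suc (sym (trans (length-take r xs) (m≤n⇒m⊓n≡m r≤)))

length-reuse : ∀ n S → length (reuse (suc n) S) ≡ suc n * length S
length-reuse n []      = sym (*-zeroʳ (suc n))
length-reuse n (r ∷ S) = begin
  length ((replicate n (suc n) ++ [ y ]) ++ reuse (suc n) S)
    ≡⟨ length-++ (replicate n (suc n) ++ [ y ]) ⟩
  length (replicate n (suc n) ++ [ y ]) + length (reuse (suc n) S)
    ≡⟨ cong₂ _+_ length-block (length-reuse n S) ⟩
  suc n + suc n * length S
    ≡⟨ sym (*-suc (suc n) (length S)) ⟩
  suc n * suc (length S) ∎
  where
  y : ℕ
  y = suc n + 1 ∸ r
  length-block : length (replicate n (suc n) ++ [ y ]) ≡ suc n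
  length-block = trans (length-++ (replicate n (suc n)))
                       (trans (cong (_+ 1) (length-replicate n)) (+-comm n 1))

All-reuse : ∀ {P Q : ℕ → Set} n S → Q n → (∀ {r} → P r → Q (n + 1 ∸ r)) →
            All P S → All Q (reuse n S)
All-reuse n S qn q ps =
  All.concat⁺ (All.map⁺ (All.map (λ pr → All.++⁺ (All.replicate⁺ (n ∸ 1) qn) (q pr ∷ [])) ps))

block-offset : ∀ b c → suc (suc (b + c)) + 1 ∸ suc b ≡ 2 + c
block-offset b c = begin
  suc (b + c) + 1 ∸ b   ≡⟨ cong (_∸ b) (+-comm (suc (b + c)) 1) ⟩
  suc (suc (b + c)) ∸ b ≡⟨ cong (_∸ b) (sym (trans (+-suc b (suc c)) (cong suc (+-suc b c)))) ⟩
  b + (2 + c) ∸ b       ≡⟨ m+n∸m≡n b (2 + c) ⟩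
  2 + c                 ∎

module Lift (m : ℕ) where

  mirror : List ℕ → List ℕ
  mirror u = reverse (map (suc m ∸_) u)

  lift : List ℕ → List ℕ
  lift u = suc m ∷ mirror u

  InRange : ℕ → Set
  InRange x = 1 ≤ x × x ≤ m

  Word : List ℕ → Set
  Word u = length u ≡ m × All InRange u

  block : ℕ → List ℕ
  block r = replicate m (suc m) ++ [ suc m + 1 ∸ r ]

  word-bounded : ∀ {u} → Word u → All (_≤ suc m) u
  word-bounded (_ , u∈) = All.map (λ x∈ → m≤n⇒m≤1+n (proj₂ x∈)) u∈

  length-mirror : ∀ u → length (mirror u) ≡ length u
  length-mirror u = trans (length-reverse (map _ u)) (length-map _ u)

  length-lift : ∀ u → length u ≡ m → length (lift u) ≡ suc m
  length-lift u lu = cong suc (trans (length-mirror u) lu)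

  mirror-++ : ∀ u v → mirror (u ++ v) ≡ mirror v ++ mirror u
  mirror-++ u v = trans (cong reverse (map-++ _ u v)) (reverse-++ (map _ u) (map _ v))

  mirror-involutive : ∀ u → All (_≤ suc m) u → mirror (mirror u) ≡ u
  mirror-involutive u u≤ = begin
    reverse (map (suc m ∸_) (reverse (map (suc m ∸_) u))) ≡⟨ cong reverse (reverse-map _ (map _ u)) ⟩
    reverse (reverse (map (suc m ∸_) (map (suc m ∸_) u))) ≡⟨ reverse-involutive _ ⟩
    map (suc m ∸_) (map (suc m ∸_) u)                     ≡⟨ sym (map-∘ u) ⟩
    map (λ x → suc m ∸ (suc m ∸ x)) u                     ≡⟨ map-id-local (All.map m∸[m∸n]≡n u≤) ⟩
    u                                                     ∎

  mirror-avoids-marker : ∀ u → All (1 ≤_) u → All (_≢ suc m) (mirror u)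
  mirror-avoids-marker u 1≤u = All-resp-↭ (↭-sym (↭-reverse _)) (All.map⁺ (All.map below-marker 1≤u))
    where
    below-marker : ∀ {x} → 1 ≤ x → suc m ∸ x ≢ suc m
    below-marker {suc x} _ = <⇒≢ (s≤s (m∸n≤m m x))

  rotate-lift : ∀ a v → iterate rotl (lift (a ∷ v)) (suc (length v)) ≡ suc m ∸ a ∷ lift v
  rotate-lift a v = begin
    iterate rotl (lift (a ∷ v)) (suc (length v))
      ≡⟨ cong (iterate rotl (lift (a ∷ v))) (cong suc (sym (length-mirror v))) ⟩
    iterate rotl (lift (a ∷ v)) (length (lift v))
      ≡⟨ cong (λ w → iterate rotl (suc m ∷ w) (length (lift v))) (mirror-++ [ a ] v) ⟩
    iterate rotl (lift v ++ [ suc m ∸ a ]) (length (lift v))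
      ≡⟨ iterate-rotl-++ (lift v) [ suc m ∸ a ] ⟩
    suc m ∸ a ∷ lift v ∎

  σ-lift : ∀ a b c → σ (2 + length c) (suc m ∸ a ∷ lift (b ++ c)) ≡ lift (b ++ a ∷ c)
  σ-lift a b c = begin
    σ (2 + length c) (suc m ∸ a ∷ suc m ∷ mirror (b ++ c))
      ≡⟨ cong₂ (λ k w → σ k (suc m ∸ a ∷ suc m ∷ w))
               (cong (2 +_) (sym (length-mirror c))) (mirror-++ b c) ⟩
    σ (length (suc m ∸ a ∷ suc m ∷ mirror c)) ((suc m ∸ a ∷ suc m ∷ mirror c) ++ mirror b)
      ≡⟨ σ-++ (suc m ∸ a ∷ suc m ∷ mirror c) (mirror b) ⟩
    suc m ∷ (mirror c ++ [ suc m ∸ a ]) ++ mirror b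
      ≡⟨ cong (suc m ∷_) (++-assoc (mirror c) [ suc m ∸ a ] (mirror b)) ⟩
    suc m ∷ mirror c ++ suc m ∸ a ∷ mirror b
      ≡⟨ cong (λ w → suc m ∷ mirror c ++ w) (sym (mirror-++ b [ a ])) ⟩
    suc m ∷ mirror c ++ mirror (b ++ [ a ])
      ≡⟨ cong (suc m ∷_) (sym (mirror-++ (b ++ [ a ]) c)) ⟩
    lift ((b ++ [ a ]) ++ c)
      ≡⟨ cong lift (++-assoc b [ a ] c) ⟩
    lift (b ++ a ∷ c) ∎

  final-block-split : ∀ a b c → length (a ∷ b ++ c) ≡ m →
                      final (lift (a ∷ b ++ c)) (block (suc (length b))) ≡ lift (b ++ a ∷ c)
  final-block-split a b c lu = begin
    final (lift (a ∷ b ++ c)) (block (suc (length b)))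
      ≡⟨ final-rotations (lift (a ∷ b ++ c)) m _ (length-lift (a ∷ b ++ c) lu) ⟩
    σ (suc m + 1 ∸ suc (length b)) (iterate rotl (lift (a ∷ b ++ c)) m)
      ≡⟨ cong (λ k → σ (suc k + 1 ∸ suc (length b)) (iterate rotl (lift (a ∷ b ++ c)) k)) (sym lu) ⟩
    σ (suc (suc (length (b ++ c))) + 1 ∸ suc (length b))
      (iterate rotl (lift (a ∷ b ++ c)) (suc (length (b ++ c))))
      ≡⟨ cong₂ σ offset (rotate-lift a (b ++ c)) ⟩
    σ (2 + length c) (suc m ∸ a ∷ lift (b ++ c))
      ≡⟨ σ-lift a b c ⟩
    lift (b ++ a ∷ c) ∎
    where
    offset : suc (suc (length (b ++ c))) + 1 ∸ suc (length b) ≡ 2 + length c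
    offset = trans (cong (λ k → suc (suc k) + 1 ∸ suc (length b)) (length-++ b))
                   (block-offset (length b) (length c))

  final-block : ∀ u r → length u ≡ m → 1 ≤ r → r ≤ m → final (lift u) (block r) ≡ lift (σ r u)
  final-block u r lu 1≤r r≤m with split-prefix r u 1≤r (subst (r ≤_) (sym lu) r≤m)
  ... | a , b , c , refl , refl =
    trans (final-block-split a b c lu) (cong lift (sym (σ-prefix a b c)))

  -- Cutting the i-th rotation of lift u at the marker suc m gives the two pieces of ū; the number
  -- of letters after the marker is m for i = 0 and i − 1 otherwise.
  reassemble : List ℕ × List ℕ → List ℕ × ℕ
  reassemble (p , q) = mirror (q ++ p) , length q

  decode : List ℕ → List ℕ × ℕ
  decode y = reassemble (cutAt (suc m) y)

  decode-rotation : ∀ u → Word u → ∀ i → i < m → decode (iterate rotl (lift u) (suc i)) ≡ (u , i)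
  decode-rotation u (lu , u∈) i i<m = begin
    decode (iterate rotl (mirror u ++ [ suc m ]) i)
      ≡⟨ cong decode (iterate-rotl-split i (mirror u) [ suc m ] (subst (i ≤_) (sym lw) (<⇒≤ i<m))) ⟩
    decode (drop i (mirror u) ++ suc m ∷ take i (mirror u))
      ≡⟨ cong reassemble (cutAt-++ (suc m) _ _ (All.drop⁺ i (mirror-avoids-marker u (All.map proj₁ u∈)))) ⟩
    mirror (take i (mirror u) ++ drop i (mirror u)) , length (take i (mirror u))
      ≡⟨ cong₂ _,_ (trans (cong mirror (take++drop≡id i (mirror u))) (mirror-involutive u (word-bounded (lu , u∈))))
                   (trans (length-take i (mirror u)) (m≤n⇒m⊓n≡m (subst (i ≤_) (sym lw) (<⇒≤ i<m)))) ⟩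
    (u , i) ∎
    where
    lw : length (mirror u) ≡ m
    lw = trans (length-mirror u) lu

  decode-lift : ∀ u → Word u → decode (lift u) ≡ (u , m)
  decode-lift u wu = begin
    decode ([] ++ suc m ∷ mirror u)             ≡⟨ cong reassemble (cutAt-++ (suc m) [] (mirror u) []) ⟩
    mirror (mirror u ++ []) , length (mirror u) ≡⟨ cong₂ _,_ (trans (cong mirror (++-identityʳ (mirror u)))
                                                                    (mirror-involutive u (word-bounded wu)))
                                                             (trans (length-mirror u) (proj₁ wu)) ⟩
    (u , m)                                     ∎

  offsets : List ℕ
  offsets = m ∷ upTo m

  offsets-unique : Unique offsets
  offsets-unique = All.map >⇒≢ (All.applyUpTo⁺₁ (λ i → i) m (λ i<m → i<m)) ∷ Unique.upTo⁺ m

  decode-rotations : ∀ u → Word u →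
                     map decode (applyUpTo (iterate rotl (lift u)) (suc m)) ≡ map (u ,_) offsets
  decode-rotations u wu = cong₂ _∷_ (decode-lift u wu) (begin
    map decode (applyUpTo (λ i → iterate rotl (lift u) (suc i)) m)   ≡⟨ map-applyUpTo _ decode m ⟩
    applyUpTo (λ i → decode (iterate rotl (lift u) (suc i))) m       ≡⟨ applyUpTo-cong-< m (decode-rotation u wu _) ⟩
    applyUpTo (u ,_) m                                               ≡⟨ sym (map-upTo (u ,_) m) ⟩
    map (u ,_) (upTo m)                                              ∎)

  σ-word : ∀ r u → Word u → Word (σ r u)
  σ-word r u (lu , u∈) = trans (length-σ r u) lu , All-σ r u∈

  visited-reuse : ∀ S u → Word u → All InRange S →
                  map decode (visited (lift u) (reuse (suc m) S)) ≡ cartesianProduct (visited u S) offsets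
  visited-reuse []      u wu []              = refl
  visited-reuse (r ∷ S) u wu ((1≤r , r≤m) ∷ S∈) = begin
    map decode (visited (lift u) (block r ++ reuse (suc m) S))
      ≡⟨ cong (map decode) (visited-++ (lift u) (block r) (reuse (suc m) S)) ⟩
    map decode (visited (lift u) (block r) ++ visited (final (lift u) (block r)) (reuse (suc m) S))
      ≡⟨ map-++ decode (visited (lift u) (block r)) _ ⟩
    map decode (visited (lift u) (block r)) ++ map decode (visited (final (lift u) (block r)) (reuse (suc m) S))
      ≡⟨ cong₂ _++_ (trans (cong (map decode) (visited-rotations (lift u) m _ (length-lift u (proj₁ wu))))
                           (decode-rotations u wu))
                    (cong (λ v → map decode (visited v (reuse (suc m) S))) (final-block u r (proj₁ wu) 1≤r r≤m)) ⟩
    map (u ,_) offsets ++ map decode (visited (lift (σ r u)) (reuse (suc m) S))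
      ≡⟨ cong (map (u ,_) offsets ++_) (visited-reuse S (σ r u) (σ-word r u wu) S∈) ⟩
    cartesianProduct (u ∷ visited (σ r u) S) offsets ∎

  final-reuse : ∀ S u → length u ≡ m → All InRange S → final (lift u) (reuse (suc m) S) ≡ lift (final u S)
  final-reuse []      u lu []                = refl
  final-reuse (r ∷ S) u lu ((1≤r , r≤m) ∷ S∈) = begin
    final (lift u) (block r ++ reuse (suc m) S)
      ≡⟨ final-++ (lift u) (block r) (reuse (suc m) S) ⟩
    final (final (lift u) (block r)) (reuse (suc m) S)
      ≡⟨ cong (λ v → final v (reuse (suc m) S)) (final-block u r lu 1≤r r≤m) ⟩
    final (lift (σ r u)) (reuse (suc m) S)
      ≡⟨ final-reuse S (σ r u) (trans (length-σ r u) lu) S∈ ⟩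
    lift (final (σ r u) S) ∎

  lift-start : lift (start m) ≡ start (suc m)
  lift-start = cong (suc m ∷_) (begin
    reverse (map (suc m ∸_) (map suc (downFrom m))) ≡⟨ cong reverse (sym (map-∘ (downFrom m))) ⟩
    reverse (map (m ∸_) (downFrom m))               ≡⟨ cong reverse (map-downFrom (m ∸_) m) ⟩
    reverse (applyDownFrom (m ∸_) m)                ≡⟨ reverse-applyDownFrom (m ∸_) m ⟩
    applyUpTo (m ∸_) m                              ≡⟨ applyUpTo-∸ m ⟩
    applyDownFrom suc m                             ≡⟨ sym (map-downFrom suc m) ⟩
    map suc (downFrom m)                            ∎)

  start-word : Word (start m)
  start-word = trans (length-map suc (downFrom m)) (length-downFrom m) ,
               All.map⁺ (All.applyDownFrom⁺₁ (λ i → i) m (λ i<m → s≤s z≤n , i<m))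

  unique-reuse : ∀ S → All InRange S → Unique (visited (start m) S) →
                 Unique (visited (start (suc m)) (reuse (suc m) S))
  unique-reuse S S∈ S-unique = subst (λ v → Unique (visited v (reuse (suc m) S))) lift-start
    (Unique.map⁻ (subst Unique (sym (visited-reuse S (start m) start-word S∈))
                               (Unique.cartesianProduct⁺ S-unique offsets-unique)))

  closed-reuse : ∀ S → All InRange S → final (start m) S ≡ start m →
                 final (start (suc m)) (reuse (suc m) S) ≡ start (suc m)
  closed-reuse S S∈ S-closed = subst (λ v → final v (reuse (suc m) S) ≡ v) lift-start
    (trans (final-reuse S (start m) (proj₁ start-word) S∈) (cong lift S-closed))

theorem2 : (n : ℕ) → 3 ≤ n → (X : ℕ → Set) →
           (∀ x → X x → 2 ≤ x × x ≤ n ∸ 1) →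
           (S : List ℕ) →
           IsHamiltonSeq (n ∸ 1) X S →
           IsHamiltonSeq n (λ r → r ≡ n ⊎ ∃[ x ] (X x × r ≡ n ∸ x + 1)) (reuse n S)
theorem2 zero    ()
theorem2 (suc m) _ X X⊆ S (S-length , S∈X , S-unique , S-closed) =
  trans (length-reuse m S) (cong (suc m *_) S-length) ,
  All-reuse (suc m) S (inj₁ refl)
    (λ {r} r∈X → inj₂ (r , r∈X , +-∸-comm 1 (m≤n⇒m≤1+n (proj₂ (X⊆ r r∈X))))) S∈X ,
  unique-reuse S S∈ S-unique ,
  closed-reuse S S∈ S-closed
  where
  open Lift m
  S∈ : All InRange S
  S∈ = All.map (λ {x} x∈X → let (2≤x , x≤m) = X⊆ x x∈X in ≤-trans (s≤s z≤n) 2≤x , x≤m) S∈X
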